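{- Let $E$ be a finite set and $\mathcal{L}$ a set of subsets of $E$ with $|\mathcal{L}|=n$, and suppose the toggle group $T(\mathcal{L})$ acts transitively on $\mathcal{L}$. If $T(\mathcal{L})$ contains a transposition, then $T(\mathcal{L})$ is the full symmetric group on $\mathcal{L}$ (so $T(\mathcal{L})\cong S_n$).
   Context: For $e\in E$, the toggle $\tau_e:\mathcal{L}\to\mathcal{L}$ is defined by $\tau_e(X)=X\triangle\{e\}$ if $X\triangle\{e\}\in\mathcal{L}$, and $\tau_e(X)=X$ otherwise. The toggle group $T(\mathcal{L})$ is the subgroup of the symmetric group on $\mathcal{L}$ generated by $\{\tau_e: e\in E\}$; its degree is $|\mathcal{L}|$. -}

module Defs where

open import Data.Nat using (ℕ)
open import Data.Bool using (Bool; not)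
open import Data.Fin using (Fin)
open import Data.Fin.Properties using (any?)
open import Data.Fin.Subset using (Subset)
open import Data.Vec using (Vec; lookup; updateAt)
open import Data.Vec.Properties using (≡-dec)
open import Data.List using (List; []; _∷_)
open import Data.Product using (Σ; ∃; _,_; _×_)
open import Relation.Nullary using (yes; no; ¬_)
open import Relation.Binary.PropositionalEquality using (_≡_)
import Data.Bool.Properties as BoolP

-- A family 𝓛 of n subsets of the ground set E = Fin m, listed without
-- repetition: L : Vec (Subset m) n with injective lookup.  Elements of 𝓛
-- are identified with their indices in Fin n.
DistinctList : ∀ {m n} → Vec (Subset m) n → Set
DistinctList {m} {n} L = ∀ (i j : Fin n) → lookup L i ≡ lookup L j → i ≡ j

flipAt : ∀ {m} → Fin m → Subset m → Subset m
flipAt e X = updateAt X e not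

_≟S_ : ∀ {m} (X Y : Subset m) → Relation.Nullary.Dec (X ≡ Y)
_≟S_ = ≡-dec BoolP._≟_

toggle : ∀ {m n} → Vec (Subset m) n → Fin m → Fin n → Fin n
toggle L e i with any? (λ k → lookup L k ≟S flipAt e (lookup L i))
... | yes (k , _) = k
... | no _ = i

evalWord : ∀ {m n} → Vec (Subset m) n → List (Fin m) → Fin n → Fin n
evalWord L [] i = i
evalWord L (e ∷ w) i = toggle L e (evalWord L w i)

-- f belongs to the toggle group T(𝓛): f is (pointwise) a product of toggles.
-- Since each τ_e is an involution, the monoid generated equals the group generated.
InToggleGroup : ∀ {m n} → Vec (Subset m) n → (Fin n → Fin n) → Set
InToggleGroup L f = ∃ λ (w : List _) → ∀ i → evalWord L w i ≡ f i

Transitive : ∀ {m n} → Vec (Subset m) n → Set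
Transitive {m} {n} L = ∀ (i j : Fin n) →
  Σ (Fin n → Fin n) λ f → InToggleGroup L f × (f i ≡ j)

-- Write i ∼ j when the transposition (i j) lies in T(𝓛). Conjugation makes ∼ an equivalence relation whose
-- classes are blocks of T(𝓛), so by transitivity it suffices that no toggle τ_e maps the class C of some X onto
-- another class: then every transposition, hence every permutation, lies in T(𝓛).
-- Suppose τ_e does; then it flips e in every member of C. Conjugating the given transposition yields Y ∼ X with
-- Y ≠ X; let w be a word for (X Y).
-- If C has a third member Z: for every word g, the symmetric difference of g Z and g (τ_e Z) does not depend on
-- Z ∈ C, since a toggle acts compatibly on two classes paired this way. For g = w, which fixes Z and τ_e Z, this
-- gives 𝓛_Y △ 𝓛_X′ = 𝓛_X △ 𝓛_X′ with X′ = τ_e X, so 𝓛_X = 𝓛_Y.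
-- If C = {X, Y}: every class is a pair, and all pairs have the same symmetric difference d. When d = {f}, every
-- word changes the f-coordinate of all sets alike, which w does not. Otherwise, for α ∈ d, the number of pairs whose
-- α-orientation a word reverses is even (τ_α reverses the pairs it moves two at a time), but it is odd for w.

module Submission where

open import Defs
open import Algebra.Bundles using (CommutativeRing)
open import Data.Bool using (Bool; true; false; not; _∧_; _xor_; if_then_else_)
open import Data.Bool.Properties
  using ( xor-assoc; xor-comm; xor-same; xor-identityʳ; ∧-zeroʳ; ∧-identityʳ; ∧-inverseˡ; ∧-distribˡ-xor; ¬-not
        ; xor-∧-commutativeRing; ⇔→≡)
  renaming (_≟_ to _≟ᵇ_)
open import Data.Empty using (⊥; ⊥-elim)
open import Data.Fin using (Fin; toℕ; funToFin; finToFun; punchIn)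
open import Data.Fin.Properties using (any?; all?; pigeonhole; toℕ-injective; toℕ≤pred[n]; finToFun-funToFin; punchInᵢ≢i)
  renaming (_≟_ to _≟ᶠ_)
import Data.Fin.Permutation.Components as PC
open import Data.Fin.Permutation using (Permutation′; permutation; transpose; _⟨$⟩ʳ_)
open import Data.Fin.Permutation.Transposition.List using (eval; decompose; eval-decompose)
open import Data.Fin.Subset using (Subset)
open import Data.List using (List; []; _∷_; _++_; [_]; reverse; length; take; drop)
open import Data.List.Properties using (reverse-involutive; unfold-reverse; length-++; length-take; length-drop; take++drop≡id)
open import Data.Maybe using (just; nothing)
open import Data.Nat using (ℕ; zero; suc; _+_; _∸_; _⊓_; _^_; _<_; _≤_; _<?_; _≤?_; z≤n; s≤s)
import Data.Nat.Properties as ℕ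
open import Data.Product using (Σ; ∃; _×_; _,_; proj₁; proj₂)
open import Data.Sum using (_⊎_; inj₁; inj₂)
import Data.Sum as Sum
open import Data.Vec using (Vec; lookup)
open import Data.Vec.Properties using (tabulate∘lookup; tabulate-cong; lookup∘updateAt; lookup∘updateAt′)
open import Function using (_∘_; _⟨_⟩_)
open import Function.Bundles using (mk⇔)
open import Relation.Binary.Definitions using (tri<; tri≈; tri>)
open import Relation.Binary.PropositionalEquality hiding ([_])
open import Relation.Nullary using (¬_; Dec; yes; no; does)
open import Relation.Nullary.Decidable using (dec-true; dec-false; _×-dec_; ¬?)
open import Tactic.RingSolver using (solve-∀)
open import Tactic.RingSolver.Core.AlmostCommutativeRing using (AlmostCommutativeRing; fromCommutativeRing)

open import Algebra.Properties.CommutativeMonoid.Sum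
  (CommutativeRing.+-commutativeMonoid xor-∧-commutativeRing)
  using (sum; sum-cong-≗; sum-replicate-zero; sum-remove; ∑-distrib-+; sum-permute)

xor-∧-ring : AlmostCommutativeRing _ _
xor-∧-ring = fromCommutativeRing xor-∧-commutativeRing λ { false → just refl ; true → nothing }

xor-absorbˡ : ∀ a b → a xor (a xor b) ≡ b
xor-absorbˡ = solve-∀ xor-∧-ring

xor-cancelˡ : ∀ a {b c} → a xor b ≡ a xor c → b ≡ c
xor-cancelˡ a {b} {c} eq = trans (sym (xor-absorbˡ a b)) (trans (cong (a xor_) eq) (xor-absorbˡ a c))

xor-cancelʳ : ∀ {a b} c → a xor c ≡ b xor c → a ≡ b
xor-cancelʳ {a} {b} c eq = xor-cancelˡ c (trans (xor-comm c a) (trans eq (xor-comm b c)))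

xor-isolate : ∀ {a b c} → a xor b ≡ c → b ≡ a xor c
xor-isolate {a} {b} eq = xor-cancelˡ a (trans eq (sym (xor-absorbˡ a _)))

xor-rotate : ∀ a b c → (a xor b) xor c ≡ (a xor c) xor b
xor-rotate = solve-∀ xor-∧-ring

xor-∧-factor : ∀ a b m m′ t → (a xor (m ∧ t)) xor (b xor (m′ ∧ t)) ≡ (a xor b) xor ((m xor m′) ∧ t)
xor-∧-factor = solve-∀ xor-∧-ring

xor-shift : ∀ a b d → a xor b ≡ (a xor d) xor (b xor d)
xor-shift = solve-∀ xor-∧-ring

<-xor->-≢ : ∀ {a b : ℕ} → a ≢ b → does (a <? b) xor does (b <? a) ≡ true
<-xor->-≢ {a} {b} a≢b with ℕ.<-cmp a b
... | tri< a<b _ b≮a rewrite dec-true (a <? b) a<b | dec-false (b <? a) b≮a = refl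
... | tri≈ _ a≡b _ = ⊥-elim (a≢b a≡b)
... | tri> a≮b _ b<a rewrite dec-false (a <? b) a≮b | dec-true (b <? a) b<a = refl

sum-false : ∀ {k} (f : Fin k → Bool) → (∀ i → f i ≡ false) → sum f ≡ false
sum-false {k} f f≗false = trans (sum-cong-≗ f≗false) (sum-replicate-zero k)

sum-single : ∀ {k} (f : Fin k → Bool) i → (∀ j → j ≢ i → f j ≡ false) → sum f ≡ f i
sum-single {suc k} f i rest = begin
  sum f                                 ≡⟨ sum-remove {i = i} f ⟩
  f i xor sum (λ j → f (punchIn i j))   ≡⟨ cong (f i xor_) (sum-false _ λ j → rest _ (punchInᵢ≢i i j)) ⟩
  f i xor false                         ≡⟨ xor-identityʳ (f i) ⟩
  f i                                   ∎
  where open ≡-Reasoning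

-- Each orbit {i, ι i} of the support is counted once in f₁ (at its smaller point) and once in f₁ ∘ ι.
sum-involution : ∀ {k} (f : Fin k → Bool) (ι : Fin k → Fin k) → (∀ i → ι (ι i) ≡ i) →
                 (∀ i → f (ι i) ≡ f i) → (∀ i → f i ≡ true → ι i ≢ i) → sum f ≡ false
sum-involution {k} f ι ι-involutive f∘ι≗f no-fixed-point = begin
  sum f                               ≡⟨ sum-cong-≗ f≗f₁+f₁∘ι ⟩
  sum (λ i → f₁ i xor f₁ (ι i))       ≡⟨ ∑-distrib-+ f₁ (λ i → f₁ (ι i)) ⟩
  sum f₁ xor sum (λ i → f₁ (ι i))     ≡⟨ cong (sum f₁ xor_) (sym (sum-permute f₁ (permutation ι ι ι-involutive ι-involutive))) ⟩
  sum f₁ xor sum f₁                   ≡⟨ xor-same (sum f₁) ⟩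
  false                               ∎
  where
  open ≡-Reasoning
  f₁ : Fin k → Bool
  f₁ i = f i ∧ does (toℕ i <? toℕ (ι i))
  f≗f₁+f₁∘ι : ∀ i → f i ≡ f₁ i xor f₁ (ι i)
  f≗f₁+f₁∘ι i rewrite f∘ι≗f i | ι-involutive i with f i in fi
  ... | false = refl
  ... | true  = sym (<-xor->-≢ (λ eq → no-fixed-point i fi (toℕ-injective (sym eq))))

δ : ∀ {m} → Fin m → Fin m → Bool
δ f x = does (x ≟ᶠ f)

δ-refl : ∀ {m} (f : Fin m) → δ f f ≡ true
δ-refl f = dec-true (f ≟ᶠ f) refl

δ-≢ : ∀ {m} {f x : Fin m} → x ≢ f → δ f x ≡ false
δ-≢ {f = f} {x} = dec-false (x ≟ᶠ f)

_△_ : ∀ {m} → Subset m → Subset m → Fin m → Bool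
(A △ B) x = lookup A x xor lookup B x

Subset-ext : ∀ {m} {A B : Subset m} → (∀ x → lookup A x ≡ lookup B x) → A ≡ B
Subset-ext {A = A} {B} eq = trans (sym (tabulate∘lookup A)) (trans (tabulate-cong eq) (tabulate∘lookup B))

lookup-flipAt : ∀ {m} (f : Fin m) (A : Subset m) x → lookup (flipAt f A) x ≡ lookup A x xor δ f x
lookup-flipAt f A x with x ≟ᶠ f
... | yes refl = trans (lookup∘updateAt x A) (xor-comm true (lookup A x))
... | no x≢f   = trans (lookup∘updateAt′ x f x≢f A) (sym (xor-identityʳ _))

flipAt-≢ : ∀ {m} (f : Fin m) (A : Subset m) → flipAt f A ≢ A
flipAt-≢ f A eq = not≢self (trans (sym (lookup∘updateAt f A)) (cong (λ B → lookup B f) eq))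
  where
  not≢self : ∀ {b} → not b ≢ b
  not≢self {false} ()
  not≢self {true} ()

flipAt-involutive : ∀ {m} (f : Fin m) (A : Subset m) → flipAt f (flipAt f A) ≡ A
flipAt-involutive f A = Subset-ext λ x → begin
  lookup (flipAt f (flipAt f A)) x      ≡⟨ lookup-flipAt f (flipAt f A) x ⟩
  lookup (flipAt f A) x xor δ f x       ≡⟨ cong (_xor δ f x) (lookup-flipAt f A x) ⟩
  (lookup A x xor δ f x) xor δ f x      ≡⟨ xor-assoc (lookup A x) (δ f x) (δ f x) ⟩
  lookup A x xor (δ f x xor δ f x)      ≡⟨ cong (lookup A x xor_) (xor-same (δ f x)) ⟩
  lookup A x xor false                  ≡⟨ xor-identityʳ (lookup A x) ⟩
  lookup A x                            ∎
  where open ≡-Reasoning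

flipAt-parallel : ∀ {m} (f : Fin m) {A B A′ B′ : Subset m} →
                  (∀ x → (A △ B) x ≡ (A′ △ B′) x) → A′ ≡ flipAt f A → B′ ≡ flipAt f B
flipAt-parallel f {A} {B} {B′ = B′} same refl = Subset-ext λ x → xor-cancelˡ (lookup (flipAt f A) x) (begin
  lookup (flipAt f A) x xor lookup B′ x                 ≡⟨ sym (same x) ⟩
  lookup A x xor lookup B x                             ≡⟨ xor-shift (lookup A x) (lookup B x) (δ f x) ⟩
  (lookup A x xor δ f x) xor (lookup B x xor δ f x)     ≡⟨ sym (cong₂ _xor_ (lookup-flipAt f A x) (lookup-flipAt f B x)) ⟩
  lookup (flipAt f A) x xor lookup (flipAt f B) x       ∎)
  where open ≡-Reasoning

_⇄_ : ∀ {n} → Fin n → Fin n → Fin n → Fin n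
i ⇄ j = transpose i j ⟨$⟩ʳ_

⇄-fromˡ : ∀ {n} (i j : Fin n) → (i ⇄ j) i ≡ j
⇄-fromˡ i j with i ≟ᶠ i
... | yes _  = refl
... | no i≢i = ⊥-elim (i≢i refl)

⇄-fromʳ : ∀ {n} (i j : Fin n) → (i ⇄ j) j ≡ i
⇄-fromʳ i j with j ≟ᶠ i
... | yes refl = refl
... | no _ with j ≟ᶠ j
...   | yes _  = refl
...   | no j≢j = ⊥-elim (j≢j refl)

⇄-other : ∀ {n} {i j k : Fin n} → k ≢ i → k ≢ j → (i ⇄ j) k ≡ k
⇄-other {i = i} {j} {k} k≢i k≢j with k ≟ᶠ i
... | yes k≡i = ⊥-elim (k≢i k≡i)
... | no _ with k ≟ᶠ j
...   | yes k≡j = ⊥-elim (k≢j k≡j)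
...   | no _    = refl

⇄-same : ∀ {n} (i k : Fin n) → (i ⇄ i) k ≡ k
⇄-same i k = by-cases (k ≟ᶠ i)
  where
  by-cases : Dec (k ≡ i) → (i ⇄ i) k ≡ k
  by-cases (yes refl) = ⇄-fromˡ k k
  by-cases (no k≢i)   = ⇄-other k≢i k≢i

⇄-comm : ∀ {n} (i j k : Fin n) → (i ⇄ j) k ≡ (j ⇄ i) k
⇄-comm i j k = by-cases (k ≟ᶠ i) (k ≟ᶠ j)
  where
  by-cases : Dec (k ≡ i) → Dec (k ≡ j) → (i ⇄ j) k ≡ (j ⇄ i) k
  by-cases (yes refl) _          = trans (⇄-fromˡ k j) (sym (⇄-fromʳ j k))
  by-cases (no _)     (yes refl) = trans (⇄-fromʳ i k) (sym (⇄-fromˡ k i))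
  by-cases (no k≢i)   (no k≢j)   = trans (⇄-other k≢i k≢j) (sym (⇄-other k≢j k≢i))

⇄-involutive : ∀ {n} (i j k : Fin n) → (i ⇄ j) ((i ⇄ j) k) ≡ k
⇄-involutive i j k = trans (cong (i ⇄ j) (⇄-comm i j k)) (PC.transpose-inverse i j)

⇄-conj : ∀ {n} (g h : Fin n → Fin n) → (∀ x → h (g x) ≡ x) → (∀ x → g (h x) ≡ x) →
         ∀ i j k → g ((i ⇄ j) (h k)) ≡ (g i ⇄ g j) k
⇄-conj g h h∘g g∘h i j k = by-cases (k ≟ᶠ g i) (k ≟ᶠ g j)
  where
  open ≡-Reasoning
  k≡g : ∀ {x} → h k ≡ x → k ≡ g x
  k≡g hk≡x = trans (sym (g∘h k)) (cong g hk≡x)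
  by-cases : Dec (k ≡ g i) → Dec (k ≡ g j) → g ((i ⇄ j) (h k)) ≡ (g i ⇄ g j) k
  by-cases (yes refl) _ = begin
    g ((i ⇄ j) (h (g i)))   ≡⟨ cong (λ z → g ((i ⇄ j) z)) (h∘g i) ⟩
    g ((i ⇄ j) i)           ≡⟨ cong g (⇄-fromˡ i j) ⟩
    g j                     ≡⟨ sym (⇄-fromˡ (g i) (g j)) ⟩
    (g i ⇄ g j) (g i)       ∎
  by-cases (no _) (yes refl) = begin
    g ((i ⇄ j) (h (g j)))   ≡⟨ cong (λ z → g ((i ⇄ j) z)) (h∘g j) ⟩
    g ((i ⇄ j) j)           ≡⟨ cong g (⇄-fromʳ i j) ⟩
    g i                     ≡⟨ sym (⇄-fromʳ (g i) (g j)) ⟩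
    (g i ⇄ g j) (g j)       ∎
  by-cases (no k≢gi) (no k≢gj) = begin
    g ((i ⇄ j) (h k))       ≡⟨ cong g (⇄-other (k≢gi ∘ k≡g) (k≢gj ∘ k≡g)) ⟩
    g (h k)                 ≡⟨ g∘h k ⟩
    k                       ≡⟨ sym (⇄-other k≢gi k≢gj) ⟩
    (g i ⇄ g j) k           ∎

module Toggling {m n : ℕ} (L : Vec (Subset m) n) (distinct : DistinctList L) where

  L[_] : Fin n → Subset m
  L[ i ] = lookup L i

  τ : Fin m → Fin n → Fin n
  τ = toggle L

  toggle-flips : ∀ f W → τ f W ≢ W → L[ τ f W ] ≡ flipAt f L[ W ]
  toggle-flips f W moves with any? (λ k → L[ k ] ≟S flipAt f L[ W ])
  ... | yes (_ , hit) = hit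
  ... | no _          = ⊥-elim (moves refl)

  toggle-hits : ∀ f W V → L[ V ] ≡ flipAt f L[ W ] → τ f W ≡ V
  toggle-hits f W V hit with any? (λ k → L[ k ] ≟S flipAt f L[ W ])
  ... | yes (U , U-hit) = distinct U V (trans U-hit (sym hit))
  ... | no no-hit       = ⊥-elim (no-hit (V , hit))

  toggle-involutive : ∀ f W → τ f (τ f W) ≡ W
  toggle-involutive f W with τ f W ≟ᶠ W
  ... | yes fixed = trans (cong (τ f) fixed) fixed
  ... | no moves  = toggle-hits f (τ f W) W (begin
    L[ W ]                         ≡⟨ sym (flipAt-involutive f L[ W ]) ⟩
    flipAt f (flipAt f L[ W ])     ≡⟨ cong (flipAt f) (sym (toggle-flips f W moves)) ⟩
    flipAt f L[ τ f W ]            ∎)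
    where open ≡-Reasoning

  moved : Fin m → Fin n → Bool
  moved f W = not (does (τ f W ≟ᶠ W))

  moved-true : ∀ {f W} → τ f W ≢ W → moved f W ≡ true
  moved-true {f} {W} = cong not ∘ dec-false (τ f W ≟ᶠ W)

  lookup-toggle : ∀ f W x → lookup L[ τ f W ] x ≡ lookup L[ W ] x xor (moved f W ∧ δ f x)
  lookup-toggle f W x with τ f W ≟ᶠ W
  ... | yes fixed = trans (cong (λ V → lookup L[ V ] x) fixed) (sym (xor-identityʳ _))
  ... | no moves  = trans (cong (λ A → lookup A x) (toggle-flips f W moves)) (lookup-flipAt f L[ W ] x)

  moved-true⁻¹ : ∀ {f W} → moved f W ≡ true → τ f W ≢ W
  moved-true⁻¹ {f} {W} m with τ f W ≟ᶠ W
  moved-true⁻¹ () | yes _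
  ... | no moves = moves

  △-toggle : ∀ f V W x →
             (L[ τ f V ] △ L[ τ f W ]) x ≡ (L[ V ] △ L[ W ]) x xor ((moved f V xor moved f W) ∧ δ f x)
  △-toggle f V W x =
    trans (cong₂ _xor_ (lookup-toggle f V x) (lookup-toggle f W x))
          (xor-∧-factor (lookup L[ V ] x) (lookup L[ W ] x) (moved f V) (moved f W) (δ f x))

  ⟦_⟧ : List (Fin m) → Fin n → Fin n
  ⟦_⟧ = evalWord L

  ⟦⟧-++ : ∀ u v i → ⟦ u ++ v ⟧ i ≡ ⟦ u ⟧ (⟦ v ⟧ i)
  ⟦⟧-++ []      v i = refl
  ⟦⟧-++ (f ∷ u) v i = cong (τ f) (⟦⟧-++ u v i)

  ⟦reverse⟧∘⟦⟧ : ∀ w i → ⟦ reverse w ⟧ (⟦ w ⟧ i) ≡ i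
  ⟦reverse⟧∘⟦⟧ []      i = refl
  ⟦reverse⟧∘⟦⟧ (f ∷ w) i = begin
    ⟦ reverse (f ∷ w) ⟧ (τ f (⟦ w ⟧ i))     ≡⟨ cong (λ u → ⟦ u ⟧ (τ f (⟦ w ⟧ i))) (unfold-reverse f w) ⟩
    ⟦ reverse w ++ [ f ] ⟧ (τ f (⟦ w ⟧ i))  ≡⟨ ⟦⟧-++ (reverse w) [ f ] _ ⟩
    ⟦ reverse w ⟧ (τ f (τ f (⟦ w ⟧ i)))     ≡⟨ cong ⟦ reverse w ⟧ (toggle-involutive f _) ⟩
    ⟦ reverse w ⟧ (⟦ w ⟧ i)                 ≡⟨ ⟦reverse⟧∘⟦⟧ w i ⟩
    i                                       ∎
    where open ≡-Reasoning

  ⟦⟧∘⟦reverse⟧ : ∀ w i → ⟦ w ⟧ (⟦ reverse w ⟧ i) ≡ i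
  ⟦⟧∘⟦reverse⟧ w i = subst (λ u → ⟦ u ⟧ (⟦ reverse w ⟧ i) ≡ i) (reverse-involutive w) (⟦reverse⟧∘⟦⟧ (reverse w) i)

  ⟦⟧-injective : ∀ w {i j} → ⟦ w ⟧ i ≡ ⟦ w ⟧ j → i ≡ j
  ⟦⟧-injective w {i} {j} eq = trans (sym (⟦reverse⟧∘⟦⟧ w i)) (trans (cong ⟦ reverse w ⟧ eq) (⟦reverse⟧∘⟦⟧ w j))

  _∈T : (Fin n → Fin n) → Set
  g ∈T = InToggleGroup L g

  ⟦⟧∈T : ∀ w → ⟦ w ⟧ ∈T
  ⟦⟧∈T w = w , λ _ → refl

  ∈T-id : (λ i → i) ∈T
  ∈T-id = ⟦⟧∈T []

  ∈T-∘ : ∀ {g h} → g ∈T → h ∈T → (λ i → g (h i)) ∈T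
  ∈T-∘ {g} {h} (u , u≗g) (v , v≗h) = u ++ v , λ i → trans (⟦⟧-++ u v i) (trans (cong ⟦ u ⟧ (v≗h i)) (u≗g (h i)))

  ∈T-resp : ∀ {g h} → g ∈T → (∀ i → g i ≡ h i) → h ∈T
  ∈T-resp (w , w≗g) g≗h = w , λ i → trans (w≗g i) (g≗h i)

  -- Pigeonhole on the n ^ n possible values of the ⟦ drop k u ⟧, k ≤ length u: two suffixes act alike,
  -- so the part between them can be cut out.
  word-shortcut : ∀ u → n ^ n < length u → ∃ λ v → length v < length u × (∀ i → ⟦ v ⟧ i ≡ ⟦ u ⟧ i)
  word-shortcut u long = take a u ++ drop b u , shorter , same
    where
    suffix : Fin (suc (length u)) → Fin (n ^ n)
    suffix k = funToFin ⟦ drop (toℕ k) u ⟧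
    collision = pigeonhole (ℕ.m<n⇒m<1+n long) suffix
    a = toℕ (proj₁ collision)
    b = toℕ (proj₁ (proj₂ collision))
    a<b : a < b
    a<b = proj₁ (proj₂ (proj₂ collision))
    b≤|u| : b ≤ length u
    b≤|u| = toℕ≤pred[n] (proj₁ (proj₂ collision))
    same-suffix : ∀ i → ⟦ drop a u ⟧ i ≡ ⟦ drop b u ⟧ i
    same-suffix i = begin
      ⟦ drop a u ⟧ i                              ≡⟨ sym (finToFun-funToFin ⟦ drop a u ⟧ i) ⟩
      finToFun (funToFin ⟦ drop a u ⟧) i          ≡⟨ cong (λ c → finToFun c i) (proj₂ (proj₂ (proj₂ collision))) ⟩
      finToFun (funToFin ⟦ drop b u ⟧) i          ≡⟨ finToFun-funToFin ⟦ drop b u ⟧ i ⟩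
      ⟦ drop b u ⟧ i                              ∎
      where open ≡-Reasoning
    same : ∀ i → ⟦ take a u ++ drop b u ⟧ i ≡ ⟦ u ⟧ i
    same i = begin
      ⟦ take a u ++ drop b u ⟧ i                  ≡⟨ ⟦⟧-++ (take a u) (drop b u) i ⟩
      ⟦ take a u ⟧ (⟦ drop b u ⟧ i)               ≡⟨ cong ⟦ take a u ⟧ (sym (same-suffix i)) ⟩
      ⟦ take a u ⟧ (⟦ drop a u ⟧ i)               ≡⟨ sym (⟦⟧-++ (take a u) (drop a u) i) ⟩
      ⟦ take a u ++ drop a u ⟧ i                  ≡⟨ cong (λ w → ⟦ w ⟧ i) (take++drop≡id a u) ⟩
      ⟦ u ⟧ i                                     ∎
      where open ≡-Reasoning
    shorter : length (take a u ++ drop b u) < length u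
    shorter = begin-strict
      length (take a u ++ drop b u)               ≡⟨ length-++ (take a u) ⟩
      length (take a u) + length (drop b u)       ≡⟨ cong₂ _+_ (length-take a u) (length-drop b u) ⟩
      a ⊓ length u + (length u ∸ b)               ≤⟨ ℕ.+-monoˡ-≤ _ (ℕ.m⊓n≤m a (length u)) ⟩
      a + (length u ∸ b)                          <⟨ ℕ.+-monoˡ-< _ a<b ⟩
      b + (length u ∸ b)                          ≡⟨ ℕ.m+[n∸m]≡n b≤|u| ⟩
      length u                                    ∎
      where open ℕ.≤-Reasoning

  word-shorten : ∀ w → ∃ λ v → length v ≤ n ^ n × (∀ i → ⟦ v ⟧ i ≡ ⟦ w ⟧ i)
  word-shorten []      = [] , z≤n , λ _ → refl
  word-shorten (f ∷ w) with word-shorten w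
  ... | v , |v|≤ , v≗w with length (f ∷ v) ≤? n ^ n
  ...   | yes |fv|≤ = f ∷ v , |fv|≤ , λ i → cong (τ f) (v≗w i)
  ...   | no  |fv|≰ with word-shortcut (f ∷ v) (ℕ.≰⇒> |fv|≰)
  ...     | v′ , shorter , v′≗fv =
    v′ , ℕ.≤-pred (ℕ.≤-trans shorter (s≤s |v|≤)) , λ i → trans (v′≗fv i) (cong (τ f) (v≗w i))

  bounded-word? : ∀ k (P : List (Fin m) → Set) → (∀ w → Dec (P w)) → Dec (∃ λ w → length w ≤ k × P w)
  bounded-word? k P P? with P? []
  ... | yes P[] = yes ([] , z≤n , P[])
  bounded-word? zero P P? | no ¬P[] = no λ { ([] , _ , P[]) → ¬P[] P[] ; (_ ∷ _ , () , _) }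
  bounded-word? (suc k) P P? | no ¬P[] with any? (λ f → bounded-word? k (λ w → P (f ∷ w)) (λ w → P? (f ∷ w)))
  ... | yes (f , w , |w|≤ , Pfw) = yes (f ∷ w , s≤s |w|≤ , Pfw)
  ... | no ¬Pf∷ = no λ { ([] , _ , P[]) → ¬P[] P[] ; (f ∷ w , s≤s |w|≤ , Pfw) → ¬Pf∷ (f , w , |w|≤ , Pfw) }

  _∈T? : ∀ g → Dec (g ∈T)
  g ∈T? with bounded-word? (n ^ n) (λ w → ∀ i → ⟦ w ⟧ i ≡ g i) (λ w → all? (λ i → ⟦ w ⟧ i ≟ᶠ g i))
  ... | yes (w , _ , w≗g) = yes (w , w≗g)
  ... | no none = no λ (w , w≗g) → let (v , |v|≤ , v≗w) = word-shorten w in none (v , |v|≤ , λ i → trans (v≗w i) (w≗g i))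

  _∼_ : Fin n → Fin n → Set
  i ∼ j = (i ⇄ j) ∈T

  _∼?_ : ∀ i j → Dec (i ∼ j)
  i ∼? j = (i ⇄ j) ∈T?

  ∼-refl : ∀ i → i ∼ i
  ∼-refl i = ∈T-resp ∈T-id (λ k → sym (⇄-same i k))

  ∼-sym : ∀ {i j} → i ∼ j → j ∼ i
  ∼-sym {i} {j} i∼j = ∈T-resp i∼j (⇄-comm i j)

  ∼-conj : ∀ w {i j} → i ∼ j → ⟦ w ⟧ i ∼ ⟦ w ⟧ j
  ∼-conj w {i} {j} i∼j =
    ∈T-resp (∈T-∘ (⟦⟧∈T w) (∈T-∘ i∼j (⟦⟧∈T (reverse w))))
            (⇄-conj ⟦ w ⟧ ⟦ reverse w ⟧ (⟦reverse⟧∘⟦⟧ w) (⟦⟧∘⟦reverse⟧ w) i j)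

  ∼-conj⁻¹ : ∀ w {i j} → ⟦ w ⟧ i ∼ ⟦ w ⟧ j → i ∼ j
  ∼-conj⁻¹ w {i} {j} wi∼wj = subst₂ _∼_ (⟦reverse⟧∘⟦⟧ w i) (⟦reverse⟧∘⟦⟧ w j) (∼-conj (reverse w) wi∼wj)

  ∼-toggle : ∀ f {i j} → i ∼ j → τ f i ∼ τ f j
  ∼-toggle f = ∼-conj [ f ]

  -- For k ∉ {i, j}, conjugating (j k) by (i j) gives (i k).
  ∼-trans : ∀ {i j k} → i ∼ j → j ∼ k → i ∼ k
  ∼-trans {i} {j} {k} i∼j j∼k = by-cases (k ≟ᶠ i) (k ≟ᶠ j)
    where
    by-cases : Dec (k ≡ i) → Dec (k ≡ j) → i ∼ k
    by-cases (yes refl) _          = ∼-refl k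
    by-cases (no _)     (yes refl) = i∼j
    by-cases (no k≢i)   (no k≢j)   =
      subst₂ _∼_ (trans (proj₂ i∼j j) (⇄-fromʳ i j)) (trans (proj₂ i∼j k) (⇄-other k≢i k≢j)) (∼-conj (proj₁ i∼j) j∼k)

  toggle-keeps-class : ∀ f {V U} → V ∼ U → V ∼ τ f V → V ∼ τ f U
  toggle-keeps-class f V∼U V∼fV = ∼-trans V∼fV (∼-toggle f V∼U)

  toggle-leaves-class : ∀ f {V U} → V ∼ U → ¬ V ∼ τ f V → ¬ V ∼ τ f U
  toggle-leaves-class f V∼U V≁fV V∼fU = V≁fV (∼-trans V∼fU (∼-sym (∼-toggle f V∼U)))

  leaving-moves : ∀ f {V U} → V ∼ U → ¬ V ∼ τ f V → τ f U ≢ U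
  leaving-moves f {V} V∼U V≁fV fU≡U = toggle-leaves-class f V∼U V≁fV (subst (V ∼_) (sym fU≡U) V∼U)

  leaves : Fin m → Fin n → Bool
  leaves f V = not (does (V ∼? τ f V))

  ⇄-resp-∼ : ∀ {X Y} → X ∼ Y → ∀ {Z W} → Z ∼ W → (X ⇄ Y) Z ∼ (X ⇄ Y) W
  ⇄-resp-∼ (w , w≗XY) {Z} {W} Z∼W = subst₂ _∼_ (w≗XY Z) (w≗XY W) (∼-conj w Z∼W)

  leaves-resp-∼ : ∀ f {V U} → V ∼ U → leaves f V ≡ leaves f U
  leaves-resp-∼ f {V} {U} V∼U with V ∼? τ f V | U ∼? τ f U
  ... | yes _     | yes _     = refl
  ... | no _      | no _      = refl
  ... | yes stays | no leaves = ⊥-elim (leaves (∼-trans (∼-sym V∼U) (toggle-keeps-class f V∼U stays)))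
  ... | no leaves | yes stays = ⊥-elim (leaves (∼-trans V∼U (toggle-keeps-class f (∼-sym V∼U) stays)))

  module Coupling (π : Fin n → Fin n) (π-involutive : ∀ Z → π (π Z) ≡ Z)
                  (π-resp-∼ : ∀ {Z W} → Z ∼ W → π Z ∼ π W) where

    Coupled : Fin n → List (Fin m) → Set
    Coupled X w = ∀ Z → X ∼ Z → ∀ x → (L[ ⟦ w ⟧ Z ] △ L[ ⟦ w ⟧ (π Z) ]) x ≡ (L[ ⟦ w ⟧ X ] △ L[ ⟦ w ⟧ (π X) ]) x

    Coupled-π : ∀ {X} w → Coupled X w → Coupled (π X) w
    Coupled-π {X} w coupled Z πX∼Z x = begin
      (L[ g Z ] △ L[ g (π Z) ]) x             ≡⟨ xor-comm (lookup L[ g Z ] x) _ ⟩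
      (L[ g (π Z) ] △ L[ g Z ]) x             ≡⟨ cong (λ V → (L[ g (π Z) ] △ L[ g V ]) x) (sym (π-involutive Z)) ⟩
      (L[ g (π Z) ] △ L[ g (π (π Z)) ]) x     ≡⟨ coupled (π Z) X∼πZ x ⟩
      (L[ g X ] △ L[ g (π X) ]) x             ≡⟨ xor-comm (lookup L[ g X ] x) _ ⟩
      (L[ g (π X) ] △ L[ g X ]) x             ≡⟨ cong (λ V → (L[ g (π X) ] △ L[ g V ]) x) (sym (π-involutive X)) ⟩
      (L[ g (π X) ] △ L[ g (π (π X)) ]) x     ∎
      where
      open ≡-Reasoning
      g = ⟦ w ⟧
      X∼πZ : X ∼ π Z
      X∼πZ = subst (_∼ π Z) (π-involutive X) (π-resp-∼ πX∼Z)

    move-transfers : ∀ {X Z} f w → Coupled X w → X ∼ Z → ⟦ w ⟧ X ∼ τ f (⟦ w ⟧ X) → τ f (⟦ w ⟧ Z) ≢ ⟦ w ⟧ Z →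
                     τ f (⟦ w ⟧ (π Z)) ≢ ⟦ w ⟧ (π Z) × ⟦ w ⟧ (π X) ∼ τ f (⟦ w ⟧ (π Z))
    move-transfers {X} {Z} f w coupled X∼Z stays moves = moves′ , subst (g (π X) ∼_) (sym hit) (∼-conj w (π-resp-∼ X∼Z₂))
      where
      g = ⟦ w ⟧
      Z₂ = ⟦ reverse w ⟧ (τ f (g Z))
      gZ₂ : g Z₂ ≡ τ f (g Z)
      gZ₂ = ⟦⟧∘⟦reverse⟧ w _
      X∼Z₂ : X ∼ Z₂
      X∼Z₂ = ∼-conj⁻¹ w (subst (g X ∼_) (sym gZ₂) (toggle-keeps-class f (∼-conj w X∼Z) stays))
      flips : L[ g (π Z₂) ] ≡ flipAt f L[ g (π Z) ]
      flips = flipAt-parallel f (λ x → trans (coupled Z X∼Z x) (sym (coupled Z₂ X∼Z₂ x)))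
                                (trans (cong L[_] gZ₂) (toggle-flips f (g Z) moves))
      hit : τ f (g (π Z)) ≡ g (π Z₂)
      hit = toggle-hits f _ _ flips
      moves′ : τ f (g (π Z)) ≢ g (π Z)
      moves′ fixed = flipAt-≢ f L[ g (π Z) ] (trans (sym flips) (cong L[_] (trans (sym hit) fixed)))

    keeps-leaves⇒fixed : ∀ {X Z} f w → Coupled X w → X ∼ Z → ⟦ w ⟧ X ∼ τ f (⟦ w ⟧ X) →
                         ¬ ⟦ w ⟧ (π X) ∼ τ f (⟦ w ⟧ (π X)) → moved f (⟦ w ⟧ Z) ≡ false
    keeps-leaves⇒fixed {X} {Z} f w coupled X∼Z stays leaves′ with τ f (⟦ w ⟧ Z) ≟ᶠ ⟦ w ⟧ Z
    ... | yes _    = refl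
    ... | no moves = ⊥-elim (toggle-leaves-class f (∼-conj w (π-resp-∼ X∼Z)) leaves′
                                                 (proj₂ (move-transfers f w coupled X∼Z stays moves)))

    keeps-keeps⇒same : ∀ {X Z} f w → Coupled X w → X ∼ Z → ⟦ w ⟧ X ∼ τ f (⟦ w ⟧ X) →
                       ⟦ w ⟧ (π X) ∼ τ f (⟦ w ⟧ (π X)) → moved f (⟦ w ⟧ Z) ≡ moved f (⟦ w ⟧ (π Z))
    keeps-keeps⇒same {X} {Z} f w coupled X∼Z stays stays′ = ⇔→≡ (mk⇔ forward backward)
      where
      g = ⟦ w ⟧
      forward : moved f (g Z) ≡ true → moved f (g (π Z)) ≡ true
      forward m = moved-true (proj₁ (move-transfers f w coupled X∼Z stays (moved-true⁻¹ m)))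
      backward : moved f (g (π Z)) ≡ true → moved f (g Z) ≡ true
      backward m = moved-true (subst (λ V → τ f (g V) ≢ g V) (π-involutive Z)
        (proj₁ (move-transfers f w (Coupled-π w coupled) (π-resp-∼ X∼Z) stays′ (moved-true⁻¹ m))))

    -- τ f moves every element of a class it leaves, and by move-transfers the elements it moves inside
    -- a class it keeps come in π-pairs.
    moved-xor : ∀ {X Z} f w → Coupled X w → X ∼ Z →
                moved f (⟦ w ⟧ Z) xor moved f (⟦ w ⟧ (π Z)) ≡ leaves f (⟦ w ⟧ X) xor leaves f (⟦ w ⟧ (π X))
    moved-xor {X} {Z} f w coupled X∼Z with ⟦ w ⟧ X ∼? τ f (⟦ w ⟧ X) | ⟦ w ⟧ (π X) ∼? τ f (⟦ w ⟧ (π X))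
    ... | yes stays | yes stays′ =
      trans (cong (_xor moved f (⟦ w ⟧ (π Z))) (keeps-keeps⇒same f w coupled X∼Z stays stays′)) (xor-same (moved f (⟦ w ⟧ (π Z))))
    ... | yes stays | no leaves′ =
      cong₂ _xor_ (keeps-leaves⇒fixed f w coupled X∼Z stays leaves′)
                  (moved-true (leaving-moves f (∼-conj w (π-resp-∼ X∼Z)) leaves′))
    ... | no leaves | yes stays′ =
      cong₂ _xor_ (moved-true (leaving-moves f (∼-conj w X∼Z) leaves))
                  (keeps-leaves⇒fixed f w (Coupled-π w coupled) (π-resp-∼ X∼Z) stays′
                                      (subst (λ V → ¬ ⟦ w ⟧ V ∼ τ f (⟦ w ⟧ V)) (sym (π-involutive X)) leaves))
    ... | no leaves | no leaves′ =
      cong₂ _xor_ (moved-true (leaving-moves f (∼-conj w X∼Z) leaves))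
                  (moved-true (leaving-moves f (∼-conj w (π-resp-∼ X∼Z)) leaves′))

    Coupled-∷ : ∀ {X} f w → Coupled X w → Coupled X (f ∷ w)
    Coupled-∷ {X} f w coupled Z X∼Z x = begin
      (L[ τ f (g Z) ] △ L[ τ f (g (π Z)) ]) x
        ≡⟨ △-toggle f (g Z) (g (π Z)) x ⟩
      (L[ g Z ] △ L[ g (π Z) ]) x xor ((moved f (g Z) xor moved f (g (π Z))) ∧ δ f x)
        ≡⟨ cong₂ (λ d c → d xor (c ∧ δ f x)) (coupled Z X∼Z x)
                 (trans (moved-xor f w coupled X∼Z) (sym (moved-xor f w coupled (∼-refl X)))) ⟩
      (L[ g X ] △ L[ g (π X) ]) x xor ((moved f (g X) xor moved f (g (π X))) ∧ δ f x)
        ≡⟨ sym (△-toggle f (g X) (g (π X)) x) ⟩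
      (L[ τ f (g X) ] △ L[ τ f (g (π X)) ]) x ∎
      where
      open ≡-Reasoning
      g = ⟦ w ⟧

    coupled-everywhere : ∀ {X} → Coupled X [] → ∀ w → Coupled X w
    coupled-everywhere base []      = base
    coupled-everywhere base (f ∷ w) = Coupled-∷ f w (coupled-everywhere base w)

  module Separated (transitive : Transitive L) {a b : Fin n} (a≢b : a ≢ b) (a∼b : a ∼ b)
                   (X : Fin n) (e : Fin m) (X≁X′ : ¬ X ∼ τ e X) where

    X′ : Fin n
    X′ = τ e X

    reach : ∀ W → ∃ λ w → ⟦ w ⟧ X ≡ W
    reach W with transitive X W
    ... | _ , (w , w≗g) , gX≡W = w , trans (w≗g X) gX≡W

    partner : Σ (Fin n) λ Y → X ∼ Y × Y ≢ X
    partner with transitive a X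
    ... | _ , (w , w≗g) , ga≡X =
      ⟦ w ⟧ b , subst (_∼ ⟦ w ⟧ b) wa≡X (∼-conj w a∼b) , λ wb≡X → a≢b (⟦⟧-injective w (trans wa≡X (sym wb≡X)))
      where
      wa≡X : ⟦ w ⟧ a ≡ X
      wa≡X = trans (w≗g a) ga≡X

    Y : Fin n
    Y = proj₁ partner

    X∼Y : X ∼ Y
    X∼Y = proj₁ (proj₂ partner)

    Y≢X : Y ≢ X
    Y≢X = proj₂ (proj₂ partner)

    swap : List (Fin m)
    swap = proj₁ X∼Y

    swap-X : ⟦ swap ⟧ X ≡ Y
    swap-X = trans (proj₂ X∼Y X) (⇄-fromˡ X Y)

    swap-fixes : ∀ {V} → V ≢ X → V ≢ Y → ⟦ swap ⟧ V ≡ V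
    swap-fixes V≢X V≢Y = trans (proj₂ X∼Y _) (⇄-other V≢X V≢Y)

    toggle-exits : ∀ {Z V} → X ∼ Z → X ∼ V → τ e Z ≢ V
    toggle-exits X∼Z X∼V eZ≡V = toggle-leaves-class e X∼Z X≁X′ (subst (X ∼_) (sym eZ≡V) X∼V)

    X′≢X : X′ ≢ X
    X′≢X = toggle-exits (∼-refl X) (∼-refl X)

    X′≢Y : X′ ≢ Y
    X′≢Y = toggle-exits (∼-refl X) X∼Y

    △-toggle-e : ∀ {Z} → X ∼ Z → ∀ x → (L[ Z ] △ L[ τ e Z ]) x ≡ δ e x
    △-toggle-e {Z} X∼Z x = begin
      lookup L[ Z ] x xor lookup L[ τ e Z ] x               ≡⟨ cong (λ A → lookup L[ Z ] x xor lookup A x) flips ⟩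
      lookup L[ Z ] x xor lookup (flipAt e L[ Z ]) x        ≡⟨ cong (lookup L[ Z ] x xor_) (lookup-flipAt e L[ Z ] x) ⟩
      lookup L[ Z ] x xor (lookup L[ Z ] x xor δ e x)       ≡⟨ xor-absorbˡ (lookup L[ Z ] x) (δ e x) ⟩
      δ e x                                                 ∎
      where
      open ≡-Reasoning
      flips : L[ τ e Z ] ≡ flipAt e L[ Z ]
      flips = toggle-flips e Z (leaving-moves e X∼Z X≁X′)

    no-third : ∀ Z → X ∼ Z → Z ≢ X → Z ≢ Y → ⊥
    no-third Z X∼Z Z≢X Z≢Y = Y≢X (distinct Y X (Subset-ext λ x → xor-cancelʳ (lookup L[ X′ ] x) (same-△ x)))
      where
      open Coupling (τ e) (toggle-involutive e) (∼-toggle e)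
      coupled : Coupled X swap
      coupled = coupled-everywhere (λ Z′ X∼Z′ x → trans (△-toggle-e X∼Z′ x) (sym (△-toggle-e (∼-refl X) x))) swap
      same-△ : ∀ x → (L[ Y ] △ L[ X′ ]) x ≡ (L[ X ] △ L[ X′ ]) x
      same-△ x = begin
        (L[ Y ] △ L[ X′ ]) x                            ≡⟨ cong₂ (λ U V → (L[ U ] △ L[ V ]) x)
                                                            (sym swap-X) (sym (swap-fixes X′≢X X′≢Y)) ⟩
        (L[ ⟦ swap ⟧ X ] △ L[ ⟦ swap ⟧ X′ ]) x          ≡⟨ sym (coupled Z X∼Z x) ⟩
        (L[ ⟦ swap ⟧ Z ] △ L[ ⟦ swap ⟧ (τ e Z) ]) x     ≡⟨ cong₂ (λ U V → (L[ U ] △ L[ V ]) x) (swap-fixes Z≢X Z≢Y)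
                                                            (swap-fixes (toggle-exits X∼Z (∼-refl X)) (toggle-exits X∼Z X∼Y)) ⟩
        (L[ Z ] △ L[ τ e Z ]) x                         ≡⟨ △-toggle-e X∼Z x ⟩
        δ e x                                           ≡⟨ sym (△-toggle-e (∼-refl X) x) ⟩
        (L[ X ] △ L[ X′ ]) x                            ∎
        where open ≡-Reasoning

    module PairClass (pair : ∀ Z → X ∼ Z → Z ≡ X ⊎ Z ≡ Y) where

      d : Fin m → Bool
      d = L[ X ] △ L[ Y ]

      class-image : ∀ w V → ⟦ w ⟧ X ∼ V → V ≡ ⟦ w ⟧ X ⊎ V ≡ ⟦ w ⟧ Y
      class-image w V wX∼V with pair (⟦ reverse w ⟧ V) (∼-conj⁻¹ w (subst (⟦ w ⟧ X ∼_) (sym (⟦⟧∘⟦reverse⟧ w V)) wX∼V))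
      ... | inj₁ w⁻¹V≡X = inj₁ (trans (sym (⟦⟧∘⟦reverse⟧ w V)) (cong ⟦ w ⟧ w⁻¹V≡X))
      ... | inj₂ w⁻¹V≡Y = inj₂ (trans (sym (⟦⟧∘⟦reverse⟧ w V)) (cong ⟦ w ⟧ w⁻¹V≡Y))

      -- For π = (X Y) coupling is automatic, the class of X being {X, Y}.
      open Coupling (X ⇄ Y) (⇄-involutive X Y) (⇄-resp-∼ X∼Y)

      coupled : ∀ w → Coupled X w
      coupled w Z X∼Z x with pair Z X∼Z
      ... | inj₁ refl = refl
      ... | inj₂ refl = begin
        (L[ ⟦ w ⟧ Y ] △ L[ ⟦ w ⟧ ((X ⇄ Y) Y) ]) x   ≡⟨ cong (λ V → (L[ ⟦ w ⟧ Y ] △ L[ ⟦ w ⟧ V ]) x) (⇄-fromʳ X Y) ⟩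
        (L[ ⟦ w ⟧ Y ] △ L[ ⟦ w ⟧ X ]) x             ≡⟨ xor-comm (lookup L[ ⟦ w ⟧ Y ] x) _ ⟩
        (L[ ⟦ w ⟧ X ] △ L[ ⟦ w ⟧ Y ]) x             ≡⟨ cong (λ V → (L[ ⟦ w ⟧ X ] △ L[ ⟦ w ⟧ V ]) x)
                                                           (sym (⇄-fromˡ X Y)) ⟩
        (L[ ⟦ w ⟧ X ] △ L[ ⟦ w ⟧ ((X ⇄ Y) X) ]) x   ∎
        where open ≡-Reasoning

      pair-△ : ∀ w x → (L[ ⟦ w ⟧ X ] △ L[ ⟦ w ⟧ Y ]) x ≡ d x
      pair-△ []      x = refl
      pair-△ (f ∷ w) x = begin
        (L[ τ f (g X) ] △ L[ τ f (g Y) ]) x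
          ≡⟨ △-toggle f (g X) (g Y) x ⟩
        (L[ g X ] △ L[ g Y ]) x xor ((moved f (g X) xor moved f (g Y)) ∧ δ f x)
          ≡⟨ cong₂ (λ c m → c xor (m ∧ δ f x)) (pair-△ w x) moved-together ⟩
        d x xor (false ∧ δ f x)
          ≡⟨ xor-identityʳ (d x) ⟩
        d x ∎
        where
        open ≡-Reasoning
        g = ⟦ w ⟧
        gπX≡gY : g ((X ⇄ Y) X) ≡ g Y
        gπX≡gY = cong g (⇄-fromˡ X Y)
        moved-together : moved f (g X) xor moved f (g Y) ≡ false
        moved-together = begin
          moved f (g X) xor moved f (g Y)                 ≡⟨ cong (λ V → moved f (g X) xor moved f V) (sym gπX≡gY) ⟩
          moved f (g X) xor moved f (g ((X ⇄ Y) X))       ≡⟨ moved-xor f w (coupled w) (∼-refl X) ⟩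
          leaves f (g X) xor leaves f (g ((X ⇄ Y) X))     ≡⟨ cong (λ V → leaves f (g X) xor leaves f V) gπX≡gY ⟩
          leaves f (g X) xor leaves f (g Y)               ≡⟨ cong (_xor leaves f (g Y)) (leaves-resp-∼ f (∼-conj w X∼Y)) ⟩
          leaves f (g Y) xor leaves f (g Y)               ≡⟨ xor-same (leaves f (g Y)) ⟩
          false                                           ∎

      lookup-pair : ∀ w x → lookup L[ ⟦ w ⟧ Y ] x ≡ lookup L[ ⟦ w ⟧ X ] x xor d x
      lookup-pair w x = xor-isolate {lookup L[ ⟦ w ⟧ X ] x} (pair-△ w x)

      module SingletonDifference (f₀ : Fin m) (d≗δ : ∀ x → d x ≡ δ f₀ x) where

        always-moved : ∀ W → moved f₀ W ≡ true
        always-moved W with reach W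
        ... | w , refl = moved-true λ fixed → Y≢X (⟦⟧-injective w (trans (sym hit) fixed))
          where
          hit : τ f₀ (⟦ w ⟧ X) ≡ ⟦ w ⟧ Y
          hit = toggle-hits f₀ _ _ (Subset-ext λ x →
            trans (lookup-pair w x) (trans (cong (lookup L[ ⟦ w ⟧ X ] x xor_) (d≗δ x)) (sym (lookup-flipAt f₀ L[ ⟦ w ⟧ X ] x))))

        χ : Fin n → Bool
        χ W = lookup L[ W ] f₀

        χ-toggle : ∀ f V → χ (τ f V) ≡ χ V xor δ f₀ f
        χ-toggle f V = trans (lookup-toggle f V f₀) (cong (χ V xor_) (by-cases (f ≟ᶠ f₀)))
          where
          by-cases : Dec (f ≡ f₀) → moved f V ∧ δ f f₀ ≡ δ f₀ f
          by-cases (yes refl) = cong (_∧ δ f f) (always-moved V)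
          by-cases (no f≢f₀)  = trans (cong (moved f V ∧_) (δ-≢ (f≢f₀ ∘ sym))) (trans (∧-zeroʳ _) (sym (δ-≢ f≢f₀)))

        parity : List (Fin m) → Bool
        parity []      = false
        parity (f ∷ w) = δ f₀ f xor parity w

        χ-word : ∀ w V → χ (⟦ w ⟧ V) ≡ χ V xor parity w
        χ-word []      V = sym (xor-identityʳ (χ V))
        χ-word (f ∷ w) V = begin
          χ (τ f (⟦ w ⟧ V))                 ≡⟨ χ-toggle f (⟦ w ⟧ V) ⟩
          χ (⟦ w ⟧ V) xor δ f₀ f            ≡⟨ cong (_xor δ f₀ f) (χ-word w V) ⟩
          (χ V xor parity w) xor δ f₀ f     ≡⟨ xor-assoc (χ V) (parity w) (δ f₀ f) ⟩
          χ V xor (parity w xor δ f₀ f)     ≡⟨ cong (χ V xor_) (xor-comm (parity w) (δ f₀ f)) ⟩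
          χ V xor (δ f₀ f xor parity w)     ∎
          where open ≡-Reasoning

        contradiction : ⊥
        contradiction = false≢true (begin
          false                ≡⟨ sym (xor-same (χ X)) ⟩
          χ X xor χ X          ≡⟨ cong (χ X xor_) (sym χY≡χX) ⟩
          χ X xor χ Y          ≡⟨ d≗δ f₀ ⟩
          δ f₀ f₀              ≡⟨ δ-refl f₀ ⟩
          true                 ∎)
          where
          open ≡-Reasoning
          false≢true : false ≢ true
          false≢true ()
          even : false ≡ parity swap
          even = xor-cancelˡ (χ X′) (trans (xor-identityʳ (χ X′)) (trans (cong χ (sym (swap-fixes X′≢X X′≢Y))) (χ-word swap X′)))
          χY≡χX : χ Y ≡ χ X
          χY≡χX = trans (cong χ (sym swap-X)) (trans (χ-word swap X) (trans (cong (χ X xor_) (sym even)) (xor-identityʳ (χ X))))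

      module WideDifference (not-singleton : ∀ f₀ → ¬ (∀ x → d x ≡ δ f₀ x)) where

        witness : Σ (Fin m) λ α → d α ≡ true
        witness with any? (λ x → d x ≟ᵇ true)
        ... | yes found = found
        ... | no none   = ⊥-elim (Y≢X (distinct Y X (Subset-ext λ x →
          xor-cancelˡ (lookup L[ X ] x) (trans (¬-not (λ dx≡true → none (x , dx≡true))) (sym (xor-same (lookup L[ X ] x)))))))

        α : Fin m
        α = proj₁ witness

        other : ∀ W → Σ (Fin n) λ V → W ∼ V × V ≢ W
        other W with any? (λ V → (W ∼? V) ×-dec ¬? (V ≟ᶠ W))
        ... | yes found = found
        ... | no none with reach W
        ...   | w , refl = ⊥-elim (none (⟦ w ⟧ Y , ∼-conj w X∼Y , Y≢X ∘ ⟦⟧-injective w))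

        p : Fin n → Fin n
        p W = proj₁ (other W)

        p≢ : ∀ W → p W ≢ W
        p≢ W = proj₂ (proj₂ (other W))

        p-word : ∀ w → p (⟦ w ⟧ X) ≡ ⟦ w ⟧ Y
        p-word w with class-image w (p (⟦ w ⟧ X)) (proj₁ (proj₂ (other _)))
        ... | inj₁ same = ⊥-elim (p≢ _ same)
        ... | inj₂ eq   = eq

        class-pair : ∀ W V → W ∼ V → V ≡ W ⊎ V ≡ p W
        class-pair W V W∼V with reach W
        ... | w , refl = Sum.map₂ (λ eq → trans eq (sym (p-word w))) (class-image w V W∼V)

        ⟦⟧-p : ∀ w W → ⟦ w ⟧ (p W) ≡ p (⟦ w ⟧ W)
        ⟦⟧-p w W with class-pair (⟦ w ⟧ W) (⟦ w ⟧ (p W)) (∼-conj w (proj₁ (proj₂ (other W))))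
        ... | inj₁ same = ⊥-elim (p≢ W (⟦⟧-injective w same))
        ... | inj₂ eq   = eq

        p-involutive : ∀ W → p (p W) ≡ W
        p-involutive W with class-pair (p W) W (∼-sym (proj₁ (proj₂ (other W))))
        ... | inj₁ same = ⊥-elim (p≢ W (sym same))
        ... | inj₂ eq   = sym eq

        △-p : ∀ W x → (L[ W ] △ L[ p W ]) x ≡ d x
        △-p W x with reach W
        ... | w , refl = trans (cong (λ V → (L[ ⟦ w ⟧ X ] △ L[ V ]) x) (p-word w)) (pair-△ w x)

        no-α-partner : ∀ W → τ α W ≢ p W
        no-α-partner W αW≡pW = not-singleton α λ x → begin
          d x                                                 ≡⟨ sym (△-p W x) ⟩
          lookup L[ W ] x xor lookup L[ p W ] x               ≡⟨ cong (λ A → lookup L[ W ] x xor lookup A x) flips ⟩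
          lookup L[ W ] x xor lookup (flipAt α L[ W ]) x      ≡⟨ cong (lookup L[ W ] x xor_) (lookup-flipAt α L[ W ] x) ⟩
          lookup L[ W ] x xor (lookup L[ W ] x xor δ α x)     ≡⟨ xor-absorbˡ (lookup L[ W ] x) (δ α x) ⟩
          δ α x                                               ∎
          where
          open ≡-Reasoning
          flips : L[ p W ] ≡ flipAt α L[ W ]
          flips = trans (cong L[_] (sym αW≡pW)) (toggle-flips α W (λ fixed → p≢ W (trans (sym αW≡pW) fixed)))

        s : Fin n → Bool
        s W = lookup L[ W ] α xor lookup L[ X ] α

        s-p : ∀ W → s (p W) ≡ s W xor true
        s-p W = begin
          lookup L[ p W ] α xor lookup L[ X ] α                 ≡⟨ cong (_xor lookup L[ X ] α)
                                                                   (xor-isolate {lookup L[ W ] α} (trans (△-p W α) (proj₂ witness))) ⟩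
          (lookup L[ W ] α xor true) xor lookup L[ X ] α        ≡⟨ xor-rotate (lookup L[ W ] α) true (lookup L[ X ] α) ⟩
          s W xor true                                          ∎
          where open ≡-Reasoning

        s-toggle : ∀ f V → s (τ f V) ≡ s V xor (moved f V ∧ δ f α)
        s-toggle f V = trans (cong (_xor lookup L[ X ] α) (lookup-toggle f V α))
                             (xor-rotate (lookup L[ V ] α) (moved f V ∧ δ f α) (lookup L[ X ] α))

        SamePair : Fin n → Fin n → Set
        SamePair U′ U = U′ ≡ U ⊎ U′ ≡ p U

        toggle-pair : ∀ {U′ U} → SamePair U′ U → SamePair (τ α U′) (τ α U)
        toggle-pair (inj₁ refl) = inj₁ refl
        toggle-pair (inj₂ refl) = inj₂ (⟦⟧-p [ α ] _)

        moved-pair : ∀ {U′ U} → SamePair U′ U → moved α U ≡ true → moved α U′ ≡ true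
        moved-pair (inj₁ refl) m = m
        moved-pair {U = U} (inj₂ refl) m = moved-true λ fixed →
          moved-true⁻¹ m (trans (sym (p-involutive _)) (trans (cong p (trans (sym (⟦⟧-p [ α ] U)) fixed)) (p-involutive U)))

        pair-of-toggle-≢ : ∀ {U′ V} → moved α V ≡ true → SamePair U′ (τ α V) → U′ ≢ V
        pair-of-toggle-≢ m (inj₁ refl) = moved-true⁻¹ m
        pair-of-toggle-≢ {V = V} m (inj₂ refl) pαV≡V = no-α-partner V (trans (sym (p-involutive _)) (cong p pαV≡V))

        module Orientation (o : Fin n → Bool) (o-p : ∀ V → o (p V) ≡ o V xor true) where

          ρ : Fin n → Fin n
          ρ U = if o U then p U else U

          ρ-pair : ∀ U → SamePair (ρ U) U
          ρ-pair U with o U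
          ... | true  = inj₂ refl
          ... | false = inj₁ refl

          o-ρ : ∀ U → o (ρ U) ≡ false
          o-ρ U with o U in oU
          ... | true  = trans (o-p U) (cong (_xor true) oU)
          ... | false = oU

          ρ-resp : ∀ {U′ U} → SamePair U′ U → ρ U′ ≡ ρ U
          ρ-resp (inj₁ refl) = refl
          ρ-resp {U = U} (inj₂ refl) rewrite o-p U with o U
          ... | true  = refl
          ... | false = p-involutive U

          β : Fin n → Bool
          β V = not (o V) ∧ moved α V

          β-true : ∀ {V} → β V ≡ true → o V ≡ false × moved α V ≡ true
          β-true {V} βV with o V | moved α V
          ... | false | true = refl , refl

          ι : Fin n → Fin n
          ι V = if β V then ρ (τ α V) else V

          ι-on : ∀ {V} → β V ≡ true → ι V ≡ ρ (τ α V)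
          ι-on {V} βV = cong (if_then ρ (τ α V) else V) βV

          ι-off : ∀ {V} → β V ≡ false → ι V ≡ V
          ι-off {V} βV = cong (if_then ρ (τ α V) else V) βV

          β-ι-on : ∀ {V} → β V ≡ true → β (ι V) ≡ true
          β-ι-on {V} βV = trans (cong β (ι-on βV))
            (cong₂ (λ c m → not c ∧ m) (o-ρ (τ α V))
                   (moved-pair (ρ-pair (τ α V)) (moved-true λ fixed → moved-true⁻¹ (proj₂ (β-true βV))
                     (trans (sym fixed) (toggle-involutive α V)))))

          β∘ι : ∀ V → β (ι V) ≡ β V
          β∘ι V = by-cases (β V) refl
            where
            by-cases : ∀ b → β V ≡ b → β (ι V) ≡ β V
            by-cases true  βV = trans (β-ι-on βV) (sym βV)
            by-cases false βV = cong β (ι-off βV)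

          ι-involutive : ∀ V → ι (ι V) ≡ V
          ι-involutive V = by-cases (β V) refl
            where
            open ≡-Reasoning
            by-cases : ∀ b → β V ≡ b → ι (ι V) ≡ V
            by-cases false βV = trans (cong ι (ι-off βV)) (ι-off βV)
            by-cases true  βV = begin
              ι (ι V)                  ≡⟨ ι-on (β-ι-on βV) ⟩
              ρ (τ α (ι V))            ≡⟨ ρ-resp (toggle-pair (Sum.map (trans (ι-on βV)) (trans (ι-on βV)) (ρ-pair (τ α V)))) ⟩
              ρ (τ α (τ α V))          ≡⟨ cong ρ (toggle-involutive α V) ⟩
              ρ V                      ≡⟨ cong (if_then p V else V) (proj₁ (β-true βV)) ⟩
              V                        ∎

          ι-no-fixed-point : ∀ V → β V ≡ true → ι V ≢ V
          ι-no-fixed-point V βV = pair-of-toggle-≢ (proj₂ (β-true βV)) (Sum.map (trans (ι-on βV)) (trans (ι-on βV)) (ρ-pair (τ α V)))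

          negatively-oriented-moved-even : sum β ≡ false
          negatively-oriented-moved-even = sum-involution β ι ι-involutive β∘ι ι-no-fixed-point

        reversals : List (Fin m) → Bool
        reversals w = sum (λ W → not (s W) ∧ s (⟦ w ⟧ W))

        α-reversals-even : ∀ w → sum (λ W → not (s W) ∧ moved α (⟦ w ⟧ W)) ≡ false
        α-reversals-even w = begin
          sum (λ W → not (s W) ∧ moved α (⟦ w ⟧ W))    ≡⟨ sum-cong-≗ (λ W → cong (λ V → not (s V) ∧ moved α (⟦ w ⟧ W))
                                                                             (sym (⟦reverse⟧∘⟦⟧ w W))) ⟩
          sum (λ W → β (⟦ w ⟧ W))                      ≡⟨ sym (sum-permute β
                                                             (permutation ⟦ w ⟧ ⟦ reverse w ⟧ (⟦⟧∘⟦reverse⟧ w) (⟦reverse⟧∘⟦⟧ w))) ⟩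
          sum β                                        ≡⟨ negatively-oriented-moved-even ⟩
          false                                        ∎
          where
          open ≡-Reasoning
          o-p : ∀ V → s (⟦ reverse w ⟧ (p V)) ≡ s (⟦ reverse w ⟧ V) xor true
          o-p V = trans (cong s (⟦⟧-p (reverse w) V)) (s-p _)
          open Orientation (λ V → s (⟦ reverse w ⟧ V)) o-p

        reversals-word : ∀ w → reversals w ≡ false
        reversals-word []      = sum-false _ (λ W → ∧-inverseˡ (s W))
        reversals-word (f ∷ w) = begin
          sum (λ W → not (s W) ∧ s (τ f (g W)))
            ≡⟨ sum-cong-≗ (λ W → trans (cong (not (s W) ∧_) (s-toggle f (g W))) (∧-distribˡ-xor (not (s W)) _ _)) ⟩
          sum (λ W → (not (s W) ∧ s (g W)) xor (not (s W) ∧ (moved f (g W) ∧ δ f α)))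
            ≡⟨ ∑-distrib-+ (λ W → not (s W) ∧ s (g W)) _ ⟩
          reversals w xor sum (λ W → not (s W) ∧ (moved f (g W) ∧ δ f α))
            ≡⟨ cong₂ _xor_ (reversals-word w) (by-cases (f ≟ᶠ α)) ⟩
          false
            ∎
          where
          open ≡-Reasoning
          g = ⟦ w ⟧
          by-cases : Dec (f ≡ α) → sum (λ W → not (s W) ∧ (moved f (g W) ∧ δ f α)) ≡ false
          by-cases (yes refl) = trans (sum-cong-≗ λ W → cong (λ t → not (s W) ∧ (moved f (g W) ∧ t)) (δ-refl f)
                                                          ⟨ trans ⟩ cong (not (s W) ∧_) (∧-identityʳ _))
                                      (α-reversals-even w)
          by-cases (no f≢α)   = sum-false _ λ W → cong (λ t → not (s W) ∧ (moved f (g W) ∧ t)) (δ-≢ (f≢α ∘ sym))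
                                                  ⟨ trans ⟩ cong (not (s W) ∧_) (∧-zeroʳ _) ⟨ trans ⟩ ∧-zeroʳ _

        reversals-swap : reversals swap ≡ true
        reversals-swap = trans (sum-single _ X others) (cong₂ (λ c c′ → not c ∧ c′) sX (trans (cong s swap-X) sY))
          where
          sX : s X ≡ false
          sX = xor-same (lookup L[ X ] α)
          sY : s Y ≡ true
          sY = trans (cong s (sym (p-word []))) (trans (s-p X) (cong (_xor true) sX))
          others : ∀ W → W ≢ X → not (s W) ∧ s (⟦ swap ⟧ W) ≡ false
          others W W≢X with W ≟ᶠ Y
          ... | yes refl = cong (λ c → not c ∧ s (⟦ swap ⟧ Y)) sY
          ... | no W≢Y   = trans (cong (λ V → not (s W) ∧ s V) (swap-fixes W≢X W≢Y)) (∧-inverseˡ (s W))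

        contradiction : ⊥
        contradiction = true≢false (trans (sym reversals-swap) (reversals-word swap))
          where
          true≢false : true ≢ false
          true≢false ()

      contradiction : ⊥
      contradiction with any? (λ f₀ → all? (λ x → d x ≟ᵇ δ f₀ x))
      ... | yes (f₀ , d≗δ) = SingletonDifference.contradiction f₀ d≗δ
      ... | no wide        = WideDifference.contradiction (λ f₀ d≗δ → wide (f₀ , d≗δ))

    contradiction : ⊥
    contradiction with any? (λ Z → (X ∼? Z) ×-dec (¬? (Z ≟ᶠ X) ×-dec ¬? (Z ≟ᶠ Y)))
    ... | yes (Z , X∼Z , Z≢X , Z≢Y) = no-third Z X∼Z Z≢X Z≢Y
    ... | no none                   = PairClass.contradiction pair
      where
      pair : ∀ Z → X ∼ Z → Z ≡ X ⊎ Z ≡ Y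
      pair Z X∼Z with Z ≟ᶠ X | Z ≟ᶠ Y
      ... | yes Z≡X | _       = inj₁ Z≡X
      ... | no _    | yes Z≡Y = inj₂ Z≡Y
      ... | no Z≢X  | no Z≢Y  = ⊥-elim (none (Z , X∼Z , Z≢X , Z≢Y))

  toggles-preserve-classes : Transitive L → ∀ {a b} → a ≢ b → a ∼ b → ∀ V f → V ∼ τ f V
  toggles-preserve-classes transitive a≢b a∼b V f with V ∼? τ f V
  ... | yes V∼fV = V∼fV
  ... | no V≁fV  = ⊥-elim (Separated.contradiction transitive a≢b a∼b V f V≁fV)

  ∼-word : ∀ w {X} → (∀ V f → V ∼ τ f V) → X ∼ ⟦ w ⟧ X
  ∼-word []      _      = ∼-refl _
  ∼-word (f ∷ w) preserved = ∼-trans (∼-word w preserved) (preserved _ f)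

  ∼-complete : Transitive L → (∀ V f → V ∼ τ f V) → ∀ i j → i ∼ j
  ∼-complete transitive preserved i j with transitive i j
  ... | _ , (w , w≗g) , gi≡j = subst (i ∼_) (trans (w≗g i) gi≡j) (∼-word w preserved)

  ∼-complete⇒symmetric : (∀ i j → i ∼ j) → ∀ (σ : Permutation′ n) → (σ ⟨$⟩ʳ_) ∈T
  ∼-complete⇒symmetric complete σ = ∈T-resp (transpositions (decompose σ)) (eval-decompose σ)
    where
    transpositions : ∀ ts → (eval ts ⟨$⟩ʳ_) ∈T
    transpositions []             = ∈T-id
    transpositions ((i , j) ∷ ts) = ∈T-∘ (transpositions ts) (complete i j)

theorem3p1 : (m n : ℕ) (L : Vec (Subset m) n) → DistinctList L →
    Transitive L →
    Σ (Fin n) (λ i → Σ (Fin n) (λ j → (¬ i ≡ j) × InToggleGroup L (λ k → transpose i j ⟨$⟩ʳ k))) →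
    (σ : Permutation′ n) → InToggleGroup L (λ k → σ ⟨$⟩ʳ k)
theorem3p1 m n L distinct transitive (a , b , a≢b , a∼b) =
  ∼-complete⇒symmetric (∼-complete transitive (toggles-preserve-classes transitive a≢b a∼b))
  where open Toggling L distinct
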